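{- Let $n\ge 1$ and consider labeled chip-firing on the infinite binary tree with a self-loop at the root, starting with $2^n-1$ chips labeled $1,\dots,2^n-1$ at the root. Let $i$ be a node with $\mathrm{level}(i)=k>1$. Then for every integer $j\ge 0$ with $k+j<n$, in every complete firing sequence: (1) the firing $(\lfloor i/2\rfloor,\,j+1)$ occurs before the firing $(i,j)$, and the firing $(i,j)$ occurs before the firing $(\lfloor i/2\rfloor,\,j)$; (2) at the moment the firing $(i,j)$ occurs, node $i$ holds exactly $3$ chips.
   Context: The infinite binary tree has nodes labeled by positive integers: node $1$ is the root, node $i$ has left child $2i$, right child $2i+1$ and (for $i>1$) parent $\lfloor i/2\rfloor$; a self-loop is added at the root. The level of node $i$ is $\lfloor\log_2 i\rfloor+1$. Labeled chip-firing: chips carry distinct labels; a node holding at least $3$ chips may fire by choosing any $3$ of its chips and sending the smallest to its left child, the largest to its right child, and the middle one to its parent (the root keeps the middle chip via the self-loop). A complete firing sequence is a finite sequence of legal firings from the initial configuration to a terminal configuration (no node holding $3$ or more chips). In every complete firing sequence each node fires the same number of times (the same as in the unlabeled process). For a node $i$ and integer $j\ge 0$, $(i,j)$ denotes the $(j+1)$-th-to-last firing of node $i$ (so $(i,0)$ is the last firing of $i$). -}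

module Defs where

open import Data.Nat using (ℕ; zero; suc; _+_; _*_; _∸_; _^_; _≤_; _<_; _≡ᵇ_)
open import Data.Nat.Logarithm using (⌊log₂_⌋)
open import Data.Nat.Base using (⌊_/2⌋)
open import Data.Bool using (Bool; true; false; if_then_else_)
open import Data.List using (List; []; _∷_; length; filterᵇ; map; upTo; take; drop; foldl)
open import Data.Product using (Σ; ∃; _×_; _,_)
open import Data.Unit using (⊤)
open import Relation.Binary.PropositionalEquality using (_≡_)

level : ℕ → ℕ
level i = ⌊log₂ i ⌋ + 1

parent : ℕ → ℕ
parent i = if i ≡ᵇ 1 then 1 else ⌊ i /2⌋

-- A labeled configuration: position (node) of each chip label.
-- Only labels 1..N (N = number of chips) are meaningful.
Config : Set
Config = ℕ → ℕ

labels : ℕ → List ℕ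
labels N = map suc (upTo N)

chipsAt : ℕ → Config → ℕ → ℕ
chipsAt N c i = length (filterᵇ (λ ℓ → c ℓ ≡ᵇ i) (labels N))

record Firing : Set where
  constructor firing
  field
    node : ℕ
    small : ℕ
    mid : ℕ
    large : ℕ
open Firing public

Legal : ℕ → Config → Firing → Set
Legal N c (firing i a b d) =
  (1 ≤ a) × (a < b) × (b < d) × (d ≤ N) × (c a ≡ i) × (c b ≡ i) × (c d ≡ i)

fire : Config → Firing → Config
fire c (firing i a b d) ℓ =
  if ℓ ≡ᵇ a then 2 * i
  else if ℓ ≡ᵇ b then parent i
  else if ℓ ≡ᵇ d then 2 * i + 1
  else c ℓ

run : Config → List Firing → Config
run c fs = foldl fire c fs

ValidSeq : ℕ → Config → List Firing → Set
ValidSeq N c [] = ⊤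
ValidSeq N c (f ∷ fs) = Legal N c f × ValidSeq N (fire c f) fs

Terminal : ℕ → Config → Set
Terminal N c = (i : ℕ) → chipsAt N c i < 3

initial : Config
initial ℓ = 1

Complete : ℕ → Config → List Firing → Set
Complete N c fs = ValidSeq N c fs × Terminal N (run c fs)

countNode : ℕ → List Firing → ℕ
countNode i fs = length (filterᵇ (λ f → node f ≡ᵇ i) fs)

-- t is the (0-based) position in fs of the firing (i , j), i.e. the
-- (j+1)-th-to-last firing of node i.
IsFiringAt : List Firing → ℕ → ℕ → ℕ → Set
IsFiringAt fs i j t =
  Σ Firing λ f → Σ (List Firing) λ post →
    (drop t fs ≡ f ∷ post) × (node f ≡ i) × (countNode i post ≡ j)

configBefore : Config → List Firing → ℕ → Config
configBefore c fs t = run c (take t fs)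

-- Let R p be the number of firings of node p still to come. Performing all of them leads to the
-- terminal configuration, which has one chip on every node of level ≤ n, so
--     chips p + R (2p) + R (parent p) + R (2p+1) = [level p ≤ n] + 3 R p,
-- since a firing of q sends one chip along each edge of q in the tree with its root loop, an undirected
-- multigraph. This balance, the bound R p ≤ 2^h − h − 1 for h = n + 1 − level p, and two order constraints
-- on each edge from a node q to a child c far enough above level n (c never gets ahead of q, and q never
-- gets two firings ahead of c) hold initially and are preserved by every legal firing; in a terminal
-- configuration they force R = 0. Hence along a complete firing sequence R is at every moment the number
-- of remaining firings. Just before the firing (i, j) we have R i = j + 1 and just after it R i = j, and
-- the order constraints pin R ⌊i/2⌋ = j + 1 at that moment, which puts (⌊i/2⌋, j + 1) before and
-- (⌊i/2⌋, j) after (i, j); the balance at i then leaves room for exactly three chips.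

module Submission where

open import Data.Bool using (Bool; true; false; not; if_then_else_)
open import Data.List using (List; []; _∷_; length; filterᵇ; map; upTo; take; drop)
open import Data.List.Properties using (map-upTo; length-map; length-upTo)
open import Data.Nat
open import Data.Nat.Logarithm
open import Data.Nat.Properties
open import Algebra.Properties.CommutativeSemigroup +-commutativeSemigroup
  using (interchange; xy∙z≈xz∙y; xy∙z≈y∙xz; xy∙z≈zy∙x)
open import Data.Nat.Tactic.RingSolver using (solve-∀; solve)
open import Data.Product using (Σ; _×_; _,_; proj₁; proj₂)
open import Relation.Binary.PropositionalEquality
open import Relation.Nullary using (¬_; yes; no; contradiction)

open import Defs

≡ᵇ-≡ : ∀ {x y} → x ≡ y → (x ≡ᵇ y) ≡ true
≡ᵇ-≡ {x} {y} x≡y with x ≡ᵇ y | ≡⇒≡ᵇ x y x≡y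
... | true | _ = refl

≡ᵇ-≢ : ∀ {x y} → x ≢ y → (x ≡ᵇ y) ≡ false
≡ᵇ-≢ {x} {y} x≢y with x ≡ᵇ y | ≡ᵇ⇒≡ x y
... | false | _ = refl
... | true | x≡y = contradiction (x≡y _) x≢y

-- Opaque, so that unification sees δ x y and not an if-expression over _≡ᵇ_.
opaque
  δ : ℕ → ℕ → ℕ
  δ x y = if x ≡ᵇ y then 1 else 0

  δ-refl : ∀ x → δ x x ≡ 1
  δ-refl x rewrite ≡ᵇ-≡ {x} refl = refl

  δ-≢ : ∀ {x y} → x ≢ y → δ x y ≡ 0
  δ-≢ x≢y rewrite ≡ᵇ-≢ x≢y = refl

  δ-sym : ∀ x y → δ x y ≡ δ y x
  δ-sym x y with x ≟ y
  ... | yes refl = refl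
  ... | no x≢y = trans (δ-≢ x≢y) (sym (δ-≢ (λ y≡x → x≢y (sym y≡x))))


-- Counting chips

update : Config → ℕ → ℕ → Config
update c x v ℓ = if ℓ ≡ᵇ x then v else c ℓ

update-≢ : ∀ {x v ℓ} c → ℓ ≢ x → update c x v ℓ ≡ c ℓ
update-≢ c ℓ≢x rewrite ≡ᵇ-≢ ℓ≢x = refl

countAt : List ℕ → Config → ℕ → ℕ
countAt L c p = length (filterᵇ (λ ℓ → c ℓ ≡ᵇ p) L)

opaque
  unfolding δ

  countAt-∷ : ∀ ℓ L c p → countAt (ℓ ∷ L) c p ≡ δ (c ℓ) p + countAt L c p
  countAt-∷ ℓ L c p with c ℓ ≡ᵇ p
  ... | true = refl
  ... | false = refl

  countNode-∷ : ∀ p f fs → countNode p (f ∷ fs) ≡ δ (node f) p + countNode p fs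
  countNode-∷ p f fs with node f ≡ᵇ p
  ... | true = refl
  ... | false = refl

multiplicity : ℕ → List ℕ → ℕ
multiplicity x L = countAt L (λ ℓ → ℓ) x

countAt-update : ∀ L c x v p →
  countAt L (update c x v) p + multiplicity x L * δ (c x) p ≡ countAt L c p + multiplicity x L * δ v p
countAt-update [] c x v p = refl
countAt-update (ℓ ∷ L) c x v p
  rewrite countAt-∷ ℓ L (update c x v) p | countAt-∷ ℓ L c p | countAt-∷ ℓ L (λ ℓ → ℓ) x
  with ℓ ≟ x
... | yes refl rewrite ≡ᵇ-≡ {ℓ} refl | δ-refl ℓ =
  moved _ _ (multiplicity ℓ L) (δ v p) (δ (c ℓ) p) (countAt-update L c ℓ v p)
  where
  moved : ∀ A B o dv dc → A + o * dc ≡ B + o * dv → dv + A + suc o * dc ≡ dc + B + suc o * dv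
  moved A B o dv dc e = begin
    dv + A + suc o * dc      ≡⟨ solve (A ∷ B ∷ o ∷ dv ∷ dc ∷ []) ⟩
    dv + dc + (A + o * dc)   ≡⟨ cong (dv + dc +_) e ⟩
    dv + dc + (B + o * dv)   ≡⟨ solve (A ∷ B ∷ o ∷ dv ∷ dc ∷ []) ⟩
    dc + B + suc o * dv      ∎
    where open ≡-Reasoning
... | no ℓ≢x rewrite ≡ᵇ-≢ ℓ≢x | δ-≢ ℓ≢x =
  trans (+-assoc (δ (c ℓ) p) _ (multiplicity x L * δ (c x) p))
    (trans (cong (δ (c ℓ) p +_) (countAt-update L c x v p)) (sym (+-assoc (δ (c ℓ) p) _ (multiplicity x L * δ v p))))

multiplicity-map-suc : ∀ x L → multiplicity (suc x) (map suc L) ≡ multiplicity x L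
multiplicity-map-suc x [] = refl
multiplicity-map-suc x (ℓ ∷ L) with ℓ ≡ᵇ x
... | true = cong suc (multiplicity-map-suc x L)
... | false = multiplicity-map-suc x L

multiplicity-zero-map-suc : ∀ L → multiplicity 0 (map suc L) ≡ 0
multiplicity-zero-map-suc [] = refl
multiplicity-zero-map-suc (ℓ ∷ L) = multiplicity-zero-map-suc L

multiplicity-upTo : ∀ {x N} → x < N → multiplicity x (upTo N) ≡ 1
multiplicity-upTo {zero} {suc N} _ rewrite sym (map-upTo suc N) =
  cong suc (multiplicity-zero-map-suc (upTo N))
multiplicity-upTo {suc x} {suc N} (s≤s x<N) rewrite sym (map-upTo suc N) =
  trans (multiplicity-map-suc x (upTo N)) (multiplicity-upTo x<N)

multiplicity-labels : ∀ {x N} → 1 ≤ x → x ≤ N → multiplicity x (labels N) ≡ 1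
multiplicity-labels {suc x} {N} _ x<N = trans (multiplicity-map-suc x (upTo N)) (multiplicity-upTo x<N)

chipsAt-update : ∀ {N x} c v p → 1 ≤ x → x ≤ N →
  chipsAt N (update c x v) p + δ (c x) p ≡ chipsAt N c p + δ v p
chipsAt-update {N} {x} c v p 1≤x x≤N
  with countAt-update (labels N) c x v p
... | e rewrite multiplicity-labels 1≤x x≤N | +-identityʳ (δ (c x) p) | +-identityʳ (δ v p) = e

telescope : ∀ x y z {dx dy ex ey} → x + dx ≡ y + ex → y + dy ≡ z + ey → x + (dx + dy) ≡ z + (ex + ey)
telescope x y z {dx} {dy} {ex} {ey} e₁ e₂ = begin
  x + (dx + dy)   ≡⟨ +-assoc x dx dy ⟨
  x + dx + dy     ≡⟨ cong (_+ dy) e₁ ⟩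
  y + ex + dy     ≡⟨ xy∙z≈xz∙y y ex dy ⟩
  y + dy + ex     ≡⟨ cong (_+ ex) e₂ ⟩
  z + ey + ex     ≡⟨ +-assoc z ey ex ⟩
  z + (ey + ex)   ≡⟨ cong (z +_) (+-comm ey ex) ⟩
  z + (ex + ey)   ∎
  where open ≡-Reasoning

chipsAt-update₃ : ∀ {N a b d} c v₁ v₂ v₃ p → 1 ≤ a → a < b → b < d → d ≤ N →
  chipsAt N (update (update (update c d v₃) b v₂) a v₁) p + (δ (c a) p + δ (c b) p + δ (c d) p)
    ≡ chipsAt N c p + (δ v₁ p + δ v₂ p + δ v₃ p)
chipsAt-update₃ {N} {a} {b} {d} c v₁ v₂ v₃ p 1≤a a<b b<d d≤N =
  telescope (chipsAt N c₃ p) (chipsAt N c₁ p) (chipsAt N c p) moveAB moveD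
  where
  1≤b = ≤-trans 1≤a (<⇒≤ a<b)
  b≤N = ≤-trans (<⇒≤ b<d) d≤N
  c₁ = update c d v₃
  c₂ = update c₁ b v₂
  c₃ = update c₂ a v₁
  moveD : chipsAt N c₁ p + δ (c d) p ≡ chipsAt N c p + δ v₃ p
  moveD = chipsAt-update c v₃ p (≤-trans 1≤b (<⇒≤ b<d)) d≤N
  moveB : chipsAt N c₂ p + δ (c b) p ≡ chipsAt N c₁ p + δ v₂ p
  moveB = subst (λ v → chipsAt N c₂ p + δ v p ≡ chipsAt N c₁ p + δ v₂ p)
            (update-≢ c (<⇒≢ b<d)) (chipsAt-update c₁ v₂ p 1≤b b≤N)
  moveA : chipsAt N c₃ p + δ (c a) p ≡ chipsAt N c₂ p + δ v₁ p
  moveA = subst (λ v → chipsAt N c₃ p + δ v p ≡ chipsAt N c₂ p + δ v₁ p)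
            (trans (update-≢ c₁ (<⇒≢ a<b)) (update-≢ c (<⇒≢ (<-trans a<b b<d))))
            (chipsAt-update c₂ v₁ p 1≤a (≤-trans (<⇒≤ a<b) b≤N))
  moveAB : chipsAt N c₃ p + (δ (c a) p + δ (c b) p) ≡ chipsAt N c₁ p + (δ v₁ p + δ v₂ p)
  moveAB = telescope (chipsAt N c₃ p) (chipsAt N c₂ p) (chipsAt N c₁ p) moveA moveB


-- The binary tree with a loop at the root

child : ℕ → Bool → ℕ
child q false = 2 * q
child q true  = 2 * q + 1

child-suc : ∀ q b → child (suc q) b ≡ 2 + child q b
child-suc q false = cong suc (+-suc q (q + 0))
child-suc q true = cong (λ m → suc m + 1) (+-suc q (q + 0))

⌊child/2⌋ : ∀ q b → ⌊ child q b /2⌋ ≡ q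
⌊child/2⌋ zero false = refl
⌊child/2⌋ zero true = refl
⌊child/2⌋ (suc q) b = trans (cong ⌊_/2⌋ (child-suc q b)) (cong suc (⌊child/2⌋ q b))

child-⌊/2⌋ : ∀ i → Σ Bool λ b → child ⌊ i /2⌋ b ≡ i
child-⌊/2⌋ zero = false , refl
child-⌊/2⌋ (suc zero) = true , refl
child-⌊/2⌋ (suc (suc i)) with child-⌊/2⌋ i
... | b , e = b , trans (child-suc ⌊ i /2⌋ b) (cong (2 +_) e)

child-injectiveˡ : ∀ {x y b b′} → child x b ≡ child y b′ → x ≡ y
child-injectiveˡ {x} {y} {b} {b′} e = trans (sym (⌊child/2⌋ x b)) (trans (cong ⌊_/2⌋ e) (⌊child/2⌋ y b′))

child-false≢true : ∀ x → child x false ≢ child x true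
child-false≢true x e = 0≢1+n (+-cancelˡ-≡ (2 * x) 0 1 (trans (+-identityʳ (2 * x)) e))

≥2⇒parent≡⌊/2⌋ : ∀ {i} → 2 ≤ i → parent i ≡ ⌊ i /2⌋
≥2⇒parent≡⌊/2⌋ {suc (suc i)} _ = refl
≥2⇒parent≡⌊/2⌋ {suc zero} (s≤s ())

child-≥2 : ∀ {q} b → 1 ≤ q → 2 ≤ child q b
child-≥2 {q} false 1≤q = *-monoʳ-≤ 2 1≤q
child-≥2 {q} true 1≤q = ≤-trans (*-monoʳ-≤ 2 1≤q) (m≤m+n (2 * q) 1)

child-≥1 : ∀ {q} b → 1 ≤ q → 1 ≤ child q b
child-≥1 b 1≤q = ≤-trans (s≤s z≤n) (child-≥2 b 1≤q)

parent-child : ∀ {q} b → 1 ≤ q → parent (child q b) ≡ q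
parent-child b 1≤q = trans (≥2⇒parent≡⌊/2⌋ (child-≥2 b 1≤q)) (⌊child/2⌋ _ b)

parent-≥1 : ∀ {p} → 1 ≤ p → 1 ≤ parent p
parent-≥1 {suc zero} _ = ≤-refl
parent-≥1 {suc (suc p)} _ = s≤s z≤n

<child : ∀ {q} b → 1 ≤ q → q < child q b
<child {q} b 1≤q = subst (_< child q b) (⌊child/2⌋ q b) (⌊n/2⌋<n′ (child-≥2 b 1≤q))
  where
  ⌊n/2⌋<n′ : ∀ {i} → 2 ≤ i → ⌊ i /2⌋ < i
  ⌊n/2⌋<n′ {suc (suc i)} _ = ⌊n/2⌋<n (suc i)
  ⌊n/2⌋<n′ {suc zero} (s≤s ())

child≢ : ∀ {q} b → 1 ≤ q → child q b ≢ q
child≢ b 1≤q e = <⇒≢ (<child b 1≤q) (sym e)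

⌊log₂child⌋ : ∀ {q} b → 1 ≤ q → ⌊log₂ child q b ⌋ ≡ suc ⌊log₂ q ⌋
⌊log₂child⌋ {q} b 1≤q = begin
  ⌊log₂ child q b ⌋               ≡⟨ m∸n+n≡m 1≤⌊log₂child⌋ ⟨
  ⌊log₂ child q b ⌋ ∸ 1 + 1       ≡⟨ +-comm _ 1 ⟩
  suc (⌊log₂ child q b ⌋ ∸ 1)     ≡⟨ cong suc (⌊log₂⌊n/2⌋⌋≡⌊log₂n⌋∸1 (child q b)) ⟨
  suc ⌊log₂ ⌊ child q b /2⌋ ⌋     ≡⟨ cong (λ m → suc ⌊log₂ m ⌋) (⌊child/2⌋ q b) ⟩
  suc ⌊log₂ q ⌋                   ∎
  where
  open ≡-Reasoning
  1≤⌊log₂child⌋ : 1 ≤ ⌊log₂ child q b ⌋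
  1≤⌊log₂child⌋ = ⌊log₂⌋-mono-≤ (child-≥2 b 1≤q)


-- Chips moved by a firing

sent : ℕ → ℕ → ℕ
sent x p = δ (child x false) p + δ (parent x) p + δ (child x true) p

inflow : (ℕ → ℕ) → ℕ → ℕ
inflow R p = R (child p false) + R (parent p) + R (child p true)

δ-children : ∀ x q b′ → δ (child x false) (child q b′) + δ (child x true) (child q b′) ≡ δ x q
δ-children x q b′ with x ≟ q
δ-children x .x false | yes refl =
  trans (cong₂ _+_ (δ-refl (child x false)) (δ-≢ (λ e → child-false≢true x (sym e)))) (sym (δ-refl x))
δ-children x .x true | yes refl =
  trans (cong₂ _+_ (δ-≢ (child-false≢true x)) (δ-refl (child x true))) (sym (δ-refl x))
... | no x≢q = trans (cong₂ _+_ (apart false) (apart true)) (sym (δ-≢ x≢q))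
  where
  apart : ∀ b → δ (child x b) (child q b′) ≡ 0
  apart b = δ-≢ (λ e → x≢q (child-injectiveˡ {b = b} {b′ = b′} e))

δ-children-≥2 : ∀ x {p} → 2 ≤ p → δ (child x false) p + δ (child x true) p ≡ δ x (parent p)
δ-children-≥2 x {p} 2≤p with child-⌊/2⌋ p
... | b′ , e = begin
  δ (child x false) p + δ (child x true) p
    ≡⟨ cong (λ p → δ (child x false) p + δ (child x true) p) (sym e) ⟩
  δ (child x false) (child ⌊ p /2⌋ b′) + δ (child x true) (child ⌊ p /2⌋ b′)
    ≡⟨ δ-children x ⌊ p /2⌋ b′ ⟩
  δ x ⌊ p /2⌋
    ≡⟨ cong (δ x) (≥2⇒parent≡⌊/2⌋ 2≤p) ⟨
  δ x (parent p) ∎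
  where open ≡-Reasoning

δ-children-root : ∀ {x} → 1 ≤ x → δ (child x false) 1 + δ (child x true) 1 ≡ 0
δ-children-root 1≤x =
  cong₂ _+_ (δ-≢ (λ e → <⇒≢ (child-≥2 false 1≤x) (sym e)))
            (δ-≢ (λ e → <⇒≢ (child-≥2 true 1≤x) (sym e)))

sent≡parent+children : ∀ x p → sent x p ≡ δ (parent x) p + (δ (child x false) p + δ (child x true) p)
sent≡parent+children x p = xy∙z≈y∙xz (δ (child x false) p) (δ (parent x) p) (δ (child x true) p)

sent-≥2 : ∀ x {p} → 2 ≤ p → sent x p ≡ δ (parent x) p + δ x (parent p)
sent-≥2 x 2≤p = trans (sent≡parent+children x _) (cong (δ (parent x) _ +_) (δ-children-≥2 x 2≤p))

sent-root : ∀ {x} → 1 ≤ x → sent x 1 ≡ δ (parent x) 1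
sent-root {x} 1≤x = trans (sent≡parent+children x 1)
  (trans (cong (δ (parent x) 1 +_) (δ-children-root 1≤x)) (+-identityʳ _))

sent-root-sym : ∀ {x} → 2 ≤ x → sent x 1 ≡ sent 1 x
sent-root-sym {suc (suc x)} 2≤x =
  trans (sent-root {suc (suc x)} (s≤s z≤n)) (trans (δ-sym (parent (suc (suc x))) 1)
    (sym (trans (sent-≥2 1 2≤x) (cong (_+ δ 1 (parent (suc (suc x)))) (δ-≢ {1} {suc (suc x)} λ ())))))
sent-root-sym {suc zero} (s≤s ())

sent-sym : ∀ {x p} → 1 ≤ x → 1 ≤ p → sent x p ≡ sent p x
sent-sym {suc zero} {suc zero} _ _ = refl
sent-sym {suc zero} {suc (suc p)} _ _ = sym (sent-root-sym (s≤s (s≤s z≤n)))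
sent-sym {suc (suc x)} {suc zero} _ _ = sent-root-sym (s≤s (s≤s z≤n))
sent-sym {x@(suc (suc _))} {p@(suc (suc _))} _ _ = begin
  sent x p                          ≡⟨ sent-≥2 x (s≤s (s≤s z≤n)) ⟩
  δ (parent x) p + δ x (parent p)   ≡⟨ cong₂ _+_ (δ-sym (parent x) p) (δ-sym x (parent p)) ⟩
  δ p (parent x) + δ (parent p) x   ≡⟨ +-comm (δ p (parent x)) (δ (parent p) x) ⟩
  δ (parent p) x + δ p (parent x)   ≡⟨ sent-≥2 p (s≤s (s≤s z≤n)) ⟨
  sent p x                          ∎
  where open ≡-Reasoning

inflow-δ : ∀ x p → inflow (δ x) p ≡ sent p x
inflow-δ x p = cong₂ _+_ (cong₂ _+_ (δ-sym x (child p false)) (δ-sym x (parent p))) (δ-sym x (child p true))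

inflow-split : ∀ R x b → inflow R x ≡ R (child x b) + R (parent x) + R (child x (not b))
inflow-split R x false = refl
inflow-split R x true = xy∙z≈zy∙x (R (child x false)) (R (parent x)) (R (child x true))

inflow-+ : ∀ R S p → inflow (λ y → R y + S y) p ≡ inflow R p + inflow S p
inflow-+ R S p = trans (cong (_+ (R c₁ + S c₁)) (interchange (R c₀) (S c₀) (R (parent p)) (S (parent p))))
                       (interchange (R c₀ + R (parent p)) (S c₀ + S (parent p)) (R c₁) (S c₁))
  where
  c₀ = child p false
  c₁ = child p true

inflow-cong : ∀ {R S} → (∀ y → R y ≡ S y) → ∀ p → inflow R p ≡ inflow S p
inflow-cong R≗S p = cong₂ _+_ (cong₂ _+_ (R≗S _) (R≗S _)) (R≗S _)

Legal-node-≥1 : ∀ {N c x a b d} → (∀ ℓ → 1 ≤ c ℓ) → Legal N c (firing x a b d) → 1 ≤ x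
Legal-node-≥1 positive (_ , _ , _ , _ , refl , _ , _) = positive _

-- Moving the three chips to any node other than x lowers the count at x by three.
Legal-3≤chipsAt : ∀ {N c x a b d} → Legal N c (firing x a b d) → 3 ≤ chipsAt N c x
Legal-3≤chipsAt {N} {c} {a = a} {b} {d} (1≤a , a<b , b<d , d≤N , refl , cb , cd)
  with chipsAt-update₃ c v v v (c a) 1≤a a<b b<d d≤N
  where v = suc (c a)
... | e rewrite cb | cd | δ-refl (c a) | δ-≢ (1+n≢n {c a}) | +-identityʳ (chipsAt N c (c a)) =
  subst (3 ≤_) e (m≤n+m 3 _)

Legal-chipsAt-fire : ∀ {N c x a b d} → Legal N c (firing x a b d) → ∀ p →
  chipsAt N (fire c (firing x a b d)) p + 3 * δ x p ≡ chipsAt N c p + sent x p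
Legal-chipsAt-fire {N} {c} {a = a} {b} {d} (1≤a , a<b , b<d , d≤N , refl , cb , cd) p
  with chipsAt-update₃ c (child (c a) false) (parent (c a)) (child (c a) true) p 1≤a a<b b<d d≤N
... | e rewrite cb | cd = trans (cong (chipsAt N (fire c (firing (c a) a b d)) p +_) (thrice (δ (c a) p))) e
  where
  thrice : ∀ y → 3 * y ≡ y + y + y
  thrice = solve-∀


-- Numbers of firings

-- The number of firings of a node of height h, namely 2^h − h − 1.
fireCount : ℕ → ℕ
fireCount zero = 0
fireCount (suc h) = 2 * fireCount h + h

fireCount+h+1≡2^h : ∀ h → fireCount h + h + 1 ≡ 2 ^ h
fireCount+h+1≡2^h zero = refl
fireCount+h+1≡2^h (suc h) = trans (double (fireCount h) h) (cong (2 *_) (fireCount+h+1≡2^h h))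
  where
  double : ∀ f h → 2 * f + h + suc h + 1 ≡ 2 * (f + h + 1)
  double = solve-∀

fireCount-mono : ∀ {h h′} → h ≤ h′ → fireCount h ≤ fireCount h′
fireCount-mono z≤n = z≤n
fireCount-mono (s≤s h≤h′) = +-mono-≤ (*-monoʳ-≤ 2 (fireCount-mono h≤h′)) h≤h′

h≤1+fireCount : ∀ h → h ≤ suc (fireCount h)
h≤1+fireCount zero = z≤n
h≤1+fireCount (suc h) = s≤s (m≤n+m h (2 * fireCount h))

fireCount-≥1 : ∀ {h} → 1 ≤ fireCount h → 1 ≤ h
fireCount-≥1 {suc h} _ = s≤s z≤n

fireCount+2≰ : ∀ {h m} → m ≤ h → ¬ (2 + fireCount h ≤ m)
fireCount+2≰ {h} m≤h = <⇒≱ (s≤s (≤-trans m≤h (h≤1+fireCount h)))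

fireCount-balance : ∀ h → fireCount (pred (pred h)) + fireCount h + fireCount (pred (pred h))
                          ≡ 1 ⊓ pred h + 3 * fireCount (pred h)
fireCount-balance zero = refl
fireCount-balance (suc zero) = refl
fireCount-balance (suc (suc h)) = identity (fireCount h) h
  where
  identity : ∀ f h → f + (2 * (2 * f + h) + suc h) + f ≡ 1 + 3 * (2 * f + h)
  identity = solve-∀

fireCount-root-balance : ∀ n → fireCount n + n + (fireCount (pred n) + fireCount n + fireCount (pred n))
                               ≡ 1 ⊓ n + 3 * fireCount n
fireCount-root-balance zero = refl
fireCount-root-balance (suc n) = identity (fireCount n) n
  where
  identity : ∀ f n → 2 * f + n + suc n + (f + (2 * f + n) + f) ≡ 1 + 3 * (2 * f + n)
  identity = solve-∀

afterFiring : (ℕ → ℕ) → ℕ → ℕ → ℕ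
afterFiring R x p = R p ∸ δ x p

afterFiring-self : ∀ R {x r} → R x ≡ suc r → afterFiring R x x ≡ r
afterFiring-self R {x} R[x]≡1+r rewrite δ-refl x | R[x]≡1+r = refl

afterFiring-other : ∀ R {x p} → x ≢ p → afterFiring R x p ≡ R p
afterFiring-other R x≢p rewrite δ-≢ x≢p = refl

afterFiring-split : ∀ {R x} → 1 ≤ R x → ∀ p → R p ≡ afterFiring R x p + δ x p
afterFiring-split {R} {x} 1≤R[x] p with x ≟ p
... | yes refl rewrite δ-refl x = sym (m∸n+n≡m 1≤R[x])
... | no x≢p rewrite δ-≢ x≢p = sym (+-identityʳ (R p))


-- Positions in a firing sequence

remaining : List Firing → ℕ → ℕ → ℕ
remaining fs t p = countNode p (drop t fs)

remaining-suc : ∀ fs t p → remaining fs (suc t) p ≤ remaining fs t p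
remaining-suc [] t p = z≤n
remaining-suc (f ∷ fs) zero p = ≤-trans (m≤n+m _ (δ (node f) p)) (≤-reflexive (sym (countNode-∷ p f fs)))
remaining-suc (f ∷ fs) (suc t) p = remaining-suc fs t p

remaining-antitone : ∀ fs p {t t′} → t ≤ t′ → remaining fs t′ p ≤ remaining fs t p
remaining-antitone fs p t≤t′ = steps (≤⇒≤′ t≤t′)
  where
  steps : ∀ {t t′} → t ≤′ t′ → remaining fs t′ p ≤ remaining fs t p
  steps ≤′-refl = ≤-refl
  steps (≤′-step t≤′t′) = ≤-trans (remaining-suc fs _ p) (steps t≤′t′)

<-from-remaining : ∀ fs p {t t′} → remaining fs t p < remaining fs t′ p → t′ < t
<-from-remaining fs p rem< = ≰⇒> λ t≤t′ → <⇒≱ rem< (remaining-antitone fs p t≤t′)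

ValidSeq-drop : ∀ {N c fs} → ValidSeq N c fs → ∀ t → ValidSeq N (run c (take t fs)) (drop t fs)
ValidSeq-drop valid zero = valid
ValidSeq-drop {fs = []} valid (suc t) = valid
ValidSeq-drop {fs = f ∷ fs} (_ , valid) (suc t) = ValidSeq-drop valid t

drop-suc : ∀ t (fs : List Firing) {f post} → drop t fs ≡ f ∷ post → drop (suc t) fs ≡ post
drop-suc zero (f ∷ fs) refl = refl
drop-suc (suc t) (f ∷ fs) e = drop-suc t fs e

countNode-∷-≡ : ∀ {p f} fs → node f ≡ p → countNode p (f ∷ fs) ≡ suc (countNode p fs)
countNode-∷-≡ {f = f} fs refl = trans (countNode-∷ (node f) f fs) (cong (_+ countNode (node f) fs) (δ-refl (node f)))

countNode-∷-≢ : ∀ {p f} fs → node f ≢ p → countNode p (f ∷ fs) ≡ countNode p fs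
countNode-∷-≢ {p} {f} fs node≢p = trans (countNode-∷ p f fs) (cong (_+ countNode p fs) (δ-≢ node≢p))

IsFiringAt-remaining : ∀ fs t {p j} → IsFiringAt fs p j t → remaining fs t p ≡ suc j
IsFiringAt-remaining fs t (f , post , drop≡ , node≡ , count≡) rewrite drop≡ =
  trans (countNode-∷-≡ post node≡) (cong suc count≡)

IsFiringAt-remaining-suc : ∀ fs t {p j} → IsFiringAt fs p j t → remaining fs (suc t) p ≡ j
IsFiringAt-remaining-suc fs t (f , post , drop≡ , _ , count≡) rewrite drop-suc t fs drop≡ = count≡

IsFiringAt-remaining-other : ∀ fs t {p j q} → IsFiringAt fs p j t → p ≢ q →
                             remaining fs (suc t) q ≡ remaining fs t q
IsFiringAt-remaining-other fs t (f , post , drop≡ , node≡ , _) p≢q rewrite drop≡ | drop-suc t fs drop≡ =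
  sym (countNode-∷-≢ post (λ e → p≢q (trans (sym node≡) e)))

IsFiringAt-3≤chipsAt : ∀ {N c} fs t {p j} → ValidSeq N c fs → IsFiringAt fs p j t →
                       3 ≤ chipsAt N (configBefore c fs t) p
IsFiringAt-3≤chipsAt {N} {c} fs t valid (f , post , drop≡ , refl , _) =
  Legal-3≤chipsAt {N} {c′} (proj₁ (subst (ValidSeq N c′) drop≡ (ValidSeq-drop valid t)))
  where c′ = configBefore c fs t

firing-exists : ∀ fs p j → j < countNode p fs → Σ ℕ (IsFiringAt fs p j)
firing-exists [] p j ()
firing-exists (f ∷ fs) p j j<count with j <? countNode p fs
... | yes j<count′ = let t , firingAt = firing-exists fs p j j<count′ in suc t , firingAt
... | no j≮count′ with node f ≟ p
...   | yes node≡p = 0 , f , fs , refl , node≡p ,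
                     ≤-antisym (≮⇒≥ j≮count′) (≤-pred (subst (j <_) (countNode-∷-≡ fs node≡p) j<count))
...   | no node≢p = contradiction (subst (j <_) (countNode-∷-≢ fs node≢p) j<count) j≮count′

Interleaved : ℕ → List Firing → ℕ → ℕ → ℕ → Set
Interleaved N fs q i j =
  Σ ℕ λ t₁ → Σ ℕ λ t₂ → Σ ℕ λ t₃ →
    IsFiringAt fs q (1 + j) t₁ × IsFiringAt fs i j t₂ × IsFiringAt fs q j t₃ ×
    t₁ < t₂ × t₂ < t₃ × chipsAt N (configBefore initial fs t₂) i ≡ 3


1⊓-≥1 : ∀ {h} → 1 ≤ h → 1 ⊓ h ≡ 1
1⊓-≥1 (s≤s _) = refl

≰2+⇒≤1+ : ∀ {a h} → ¬ (2 + a ≤ h) → h ≤ 1 + a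
≰2+⇒≤1+ 2+a≰h = ≤-pred (≰⇒> 2+a≰h)

child-bound : ∀ {C P S r} → 2 + (C + P + S) ≤ 3 * suc r → suc r ≤ P → r ≤ S → C ≤ r
child-bound {C} {P} {S} {r} sum≤ r<P r≤S = +-cancelʳ-≤ (2 + (suc r + r)) C r (begin
  C + (2 + (suc r + r))   ≤⟨ +-monoʳ-≤ C (+-monoʳ-≤ 2 (+-mono-≤ r<P r≤S)) ⟩
  C + (2 + (P + S))       ≡⟨ solve (C ∷ P ∷ S ∷ []) ⟩
  2 + (C + P + S)         ≤⟨ sum≤ ⟩
  3 * suc r               ≡⟨ solve (r ∷ []) ⟩
  r + (2 + (suc r + r))   ∎)
  where open ≤-Reasoning

parent-bound : ∀ {K₀ P K₁ r} → 2 + (K₀ + P + K₁) ≤ 3 * suc r → r ≤ K₀ → r ≤ K₁ → P ≤ suc r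
parent-bound {K₀} {P} {K₁} {r} sum≤ r≤K₀ r≤K₁ = +-cancelʳ-≤ (2 + (r + r)) P (suc r) (begin
  P + (2 + (r + r))       ≤⟨ +-monoʳ-≤ P (+-monoʳ-≤ 2 (+-mono-≤ r≤K₀ r≤K₁)) ⟩
  P + (2 + (K₀ + K₁))     ≡⟨ solve (K₀ ∷ P ∷ K₁ ∷ []) ⟩
  2 + (K₀ + P + K₁)       ≤⟨ sum≤ ⟩
  3 * suc r               ≡⟨ solve (r ∷ []) ⟩
  suc r + (2 + (r + r))   ∎)
  where open ≤-Reasoning

chips-bound : ∀ {C K₀ P K₁ j} → C + (K₀ + P + K₁) ≡ 1 + 3 * suc j → P ≡ suc j →
              j ≤ K₀ → j ≤ K₁ → C ≤ 3
chips-bound {C} {K₀} {P} {K₁} {j} balance refl j≤K₀ j≤K₁ = +-cancelʳ-≤ (j + suc j + j) C 3 (begin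
  C + (j + suc j + j)   ≤⟨ +-monoʳ-≤ C (+-monoˡ-≤ j (+-monoˡ-≤ (suc j) j≤K₀)) ⟩
  C + (K₀ + suc j + j)  ≤⟨ +-monoʳ-≤ C (+-monoʳ-≤ (K₀ + suc j) j≤K₁) ⟩
  C + (K₀ + suc j + K₁) ≡⟨ balance ⟩
  1 + 3 * suc j         ≡⟨ solve (j ∷ []) ⟩
  3 + (j + suc j + j)   ∎)
  where open ≤-Reasoning

terminal-bound : ∀ {C K₀ P K₁ M} → C ≤ 2 → K₀ ≤ M → P ≤ suc M → K₁ ≤ M →
                 C + (K₀ + P + K₁) < 1 + 3 * suc M
terminal-bound {C} {K₀} {P} {K₁} {M} C≤2 K₀≤M P≤1+M K₁≤M = begin-strict
  C + (K₀ + P + K₁)     ≤⟨ +-mono-≤ C≤2 (+-mono-≤ (+-mono-≤ K₀≤M P≤1+M) K₁≤M) ⟩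
  2 + (M + suc M + M)   <⟨ ≤-refl ⟩
  3 + (M + suc M + M)   ≡⟨ solve (M ∷ []) ⟩
  1 + 3 * suc M         ∎
  where open ≤-Reasoning


-- The invariant

module Process (n : ℕ) where

  N : ℕ
  N = 2 ^ n ∸ 1

  -- height p = n + 1 − level p; opaque to keep the well-founded recursion of ⌊log₂_⌋ out of unification.
  opaque
    height : ℕ → ℕ
    height p = n ∸ ⌊log₂ p ⌋

    height≡ : ∀ p → height p ≡ n ∸ ⌊log₂ p ⌋
    height≡ p = refl

    height-root : height 1 ≡ n
    height-root = refl

    height≤n : ∀ p → height p ≤ n
    height≤n p = m∸n≤m n ⌊log₂ p ⌋

    height-child : ∀ {q} b → 1 ≤ q → height (child q b) ≡ pred (height q)
    height-child {q} b 1≤q =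
      trans (cong (n ∸_) (⌊log₂child⌋ b 1≤q)) (sym (pred[m∸n]≡m∸[1+n] n ⌊log₂ q ⌋))

  totalFirings : ℕ → ℕ
  totalFirings p = fireCount (height p)

  height-parent : ∀ {q} b → 1 ≤ q → 1 ≤ height (child q b) → height q ≡ suc (height (child q b))
  height-parent {q} b 1≤q 1≤height =
    trans (sym (suc-pred (height q) {{>-nonZero 1≤height[q]}})) (cong suc (sym (height-child b 1≤q)))
    where
    1≤height[q] : 1 ≤ height q
    1≤height[q] = ≤-trans 1≤height (≤-trans (≤-reflexive (height-child b 1≤q)) pred[n]≤n)

  height-≥2 : ∀ {p} → 2 ≤ p → height p ≡ pred (height (parent p))
  height-≥2 {p} 2≤p with child-⌊/2⌋ p
  ... | b , e = begin
    height p                       ≡⟨ cong height e ⟨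
    height (child ⌊ p /2⌋ b)       ≡⟨ height-child b (⌊n/2⌋-mono 2≤p) ⟩
    pred (height ⌊ p /2⌋)          ≡⟨ cong (λ q → pred (height q)) (≥2⇒parent≡⌊/2⌋ 2≤p) ⟨
    pred (height (parent p))       ∎
    where open ≡-Reasoning

  -- R p is the number of firings of p still to come, and 1 ⊓ height p the number of chips p ends with.
  record Invariant (c : Config) (R : ℕ → ℕ) : Set where
    field
      positions-positive : ∀ ℓ → 1 ≤ c ℓ
      balance : ∀ {p} → 1 ≤ p → chipsAt N c p + inflow R p ≡ 1 ⊓ height p + 3 * R p
      bounded : ∀ {p} → 1 ≤ p → R p ≤ totalFirings p
      child≤parent : ∀ q b → 1 ≤ q → 2 + R q ≤ height (child q b) → R (child q b) ≤ R q
      parent≤1+child : ∀ q b → 1 ≤ q → 2 + R (child q b) ≤ height (child q b) → R q ≤ 1 + R (child q b)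

  initial-balance : ∀ {p} → 1 ≤ p → chipsAt N initial p + inflow totalFirings p ≡ 1 ⊓ height p + 3 * totalFirings p
  initial-balance {suc zero} _ = begin
    chipsAt N initial 1 + (fireCount (height 2) + fireCount (height 1) + fireCount (height 3))
      ≡⟨ cong₂ _+_ all-at-root (cong₂ (λ h h′ → fireCount h + fireCount (height 1) + fireCount h′)
                                       (height-child false ≤-refl) (height-child true ≤-refl)) ⟩
    fireCount n + n + (fireCount (pred (height 1)) + fireCount (height 1) + fireCount (pred (height 1)))
      ≡⟨ cong (λ h → fireCount n + n + (fireCount (pred h) + fireCount h + fireCount (pred h))) height-root ⟩
    fireCount n + n + (fireCount (pred n) + fireCount n + fireCount (pred n))
      ≡⟨ fireCount-root-balance n ⟩
    1 ⊓ n + 3 * fireCount n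
      ≡⟨ cong (λ h → 1 ⊓ h + 3 * fireCount h) height-root ⟨
    1 ⊓ height 1 + 3 * fireCount (height 1) ∎
    where
    open ≡-Reasoning
    length-filter-true : ∀ (L : List ℕ) → length (filterᵇ (λ _ → true) L) ≡ length L
    length-filter-true [] = refl
    length-filter-true (_ ∷ L) = cong suc (length-filter-true L)
    all-at-root : chipsAt N initial 1 ≡ fireCount n + n
    all-at-root = begin
      chipsAt N initial 1        ≡⟨ length-filter-true (labels N) ⟩
      length (labels N)          ≡⟨ trans (length-map suc (upTo N)) (length-upTo N) ⟩
      2 ^ n ∸ 1                  ≡⟨ cong (_∸ 1) (fireCount+h+1≡2^h n) ⟨
      fireCount n + n + 1 ∸ 1    ≡⟨ m+n∸n≡m (fireCount n + n) 1 ⟩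
      fireCount n + n            ∎
  initial-balance {p@(suc (suc _))} _ = begin
    chipsAt N initial p + inflow totalFirings p
      ≡⟨ cong (_+ inflow totalFirings p) (none-off-root (labels N)) ⟩
    fireCount (height (child p false)) + fireCount h + fireCount (height (child p true))
      ≡⟨ cong₂ (λ h₀ h₁ → fireCount h₀ + fireCount h + fireCount h₁) (grandchild false) (grandchild true) ⟩
    fireCount (pred (pred h)) + fireCount h + fireCount (pred (pred h))
      ≡⟨ fireCount-balance h ⟩
    1 ⊓ pred h + 3 * fireCount (pred h)
      ≡⟨ cong (λ h′ → 1 ⊓ h′ + 3 * fireCount h′) (height-≥2 (s≤s (s≤s z≤n))) ⟨
    1 ⊓ height p + 3 * totalFirings p ∎
    where
    open ≡-Reasoning
    h = height (parent p)
    none-off-root : ∀ (L : List ℕ) → length (filterᵇ (λ _ → false) L) ≡ 0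
    none-off-root [] = refl
    none-off-root (_ ∷ L) = none-off-root L
    grandchild : ∀ b → height (child p b) ≡ pred (pred h)
    grandchild b = trans (height-child b (s≤s z≤n)) (cong pred (height-≥2 (s≤s (s≤s z≤n))))

  initial-invariant : Invariant initial totalFirings
  initial-invariant = record
    { positions-positive = λ _ → ≤-refl
    ; balance = initial-balance
    ; bounded = λ _ → ≤-refl
    ; child≤parent = λ q b 1≤q too-high →
        contradiction too-high (fireCount+2≰ {height q} (≤-trans (≤-reflexive (height-child b 1≤q)) pred[n]≤n))
    ; parent≤1+child = λ q b 1≤q too-high → contradiction too-high (fireCount+2≰ ≤-refl)
    }

  module _ {c R} (I : Invariant c R) where
    open Invariant I

    child≤parent′ : ∀ q b → 1 ≤ q → 1 + R (child q b) ≤ height (child q b) → R (child q b) ≤ R q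
    child≤parent′ q b 1≤q low with 2 + R q ≤? height (child q b)
    ... | yes high = child≤parent q b 1≤q high
    ... | no ¬high = ≤-pred (≤-trans low (≰2+⇒≤1+ ¬high))

    parent≤1+child′ : ∀ q b → 1 ≤ q → R q ≤ height (child q b) → R q ≤ 1 + R (child q b)
    parent≤1+child′ q b 1≤q low with 2 + R (child q b) ≤? height (child q b)
    ... | yes high = parent≤1+child q b 1≤q high
    ... | no ¬high = ≤-trans low (≰2+⇒≤1+ ¬high)

    ≤parent : ∀ {x} → 1 ≤ x → 1 + R x ≤ height x → R x ≤ R (parent x)
    ≤parent {suc zero} _ _ = ≤-refl
    ≤parent {x@(suc (suc _))} _ low with child-⌊/2⌋ x
    ... | b , e = subst (λ y → R y ≤ R ⌊ x /2⌋) e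
                    (child≤parent′ ⌊ x /2⌋ b (s≤s z≤n) (subst (λ y → 1 + R y ≤ height y) (sym e) low))

    2+inflow≤3R : ∀ {x} → 1 ≤ x → 3 ≤ chipsAt N c x → 2 + inflow R x ≤ 3 * R x
    2+inflow≤3R {x} 1≤x 3≤chips = +-cancelˡ-≤ 1 _ _ (begin
      3 + inflow R x                   ≤⟨ +-monoˡ-≤ (inflow R x) 3≤chips ⟩
      chipsAt N c x + inflow R x       ≡⟨ balance 1≤x ⟩
      1 ⊓ height x + 3 * R x           ≤⟨ +-monoˡ-≤ (3 * R x) (m⊓n≤m 1 (height x)) ⟩
      1 + 3 * R x                      ∎)
      where open ≤-Reasoning

  -- The firing decrements R x. The order constraints can only break on the edges at x, where they follow
  -- from the balance at x, a node holding at least three chips.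
  module FiringStep {c R x a b d} (I : Invariant c R) (legal : Legal N c (firing x a b d)) where
    open Invariant I

    R′ : ℕ → ℕ
    R′ = afterFiring R x

    1≤x : 1 ≤ x
    1≤x = Legal-node-≥1 positions-positive legal

    2+inflow≤3R[x] : 2 + inflow R x ≤ 3 * R x
    2+inflow≤3R[x] = 2+inflow≤3R I 1≤x (Legal-3≤chipsAt legal)

    1≤R[x] : 1 ≤ R x
    1≤R[x] = n≢0⇒n>0 λ R[x]≡0 →
      contradiction (subst (λ y → 2 + inflow R x ≤ 3 * y) R[x]≡0 2+inflow≤3R[x]) λ ()

    r : ℕ
    r = pred (R x)

    R[x]≡1+r : R x ≡ suc r
    R[x]≡1+r = sym (suc-pred (R x) {{>-nonZero 1≤R[x]}})

    R′[x]≡r : R′ x ≡ r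
    R′[x]≡r = afterFiring-self R R[x]≡1+r

    r≤R[x] : r ≤ R x
    r≤R[x] = subst (r ≤_) (sym R[x]≡1+r) (n≤1+n r)

    height-siblings : ∀ b b′ → height (child x b) ≡ height (child x b′)
    height-siblings b b′ = trans (height-child b 1≤x) (sym (height-child b′ 1≤x))

    fired-child≤parent : ∀ b → 2 + r ≤ height (child x b) → R (child x b) ≤ r
    fired-child≤parent b low = child-bound sum≤ R[x]≤R[parent] r≤R[sibling]
      where
      sum≤ : 2 + (R (child x b) + R (parent x) + R (child x (not b))) ≤ 3 * suc r
      sum≤ = subst₂ (λ s y → 2 + s ≤ 3 * y) (inflow-split R x b) R[x]≡1+r 2+inflow≤3R[x]
      R[x]≤R[parent] : suc r ≤ R (parent x)
      R[x]≤R[parent] = subst (_≤ R (parent x)) R[x]≡1+r (≤parent I 1≤x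
        (subst (λ y → 1 + y ≤ height x) (sym R[x]≡1+r)
          (≤-trans low (≤-trans (≤-reflexive (height-child b 1≤x)) pred[n]≤n))))
      r≤R[sibling] : r ≤ R (child x (not b))
      r≤R[sibling] = ≤-pred (subst (_≤ 1 + R (child x (not b))) R[x]≡1+r
        (parent≤1+child′ I x (not b) 1≤x
          (subst (_≤ height (child x (not b))) (sym R[x]≡1+r)
            (≤-trans (n≤1+n (suc r)) (≤-trans low (≤-reflexive (height-siblings b (not b))))))))

    parent≤1+fired : ∀ {q b} → 1 ≤ q → x ≡ child q b → 2 + r ≤ height x → R q ≤ suc r
    parent≤1+fired {q} {b} 1≤q x≡child low =
      subst (λ y → R y ≤ suc r) (trans (cong parent x≡child) (parent-child b 1≤q))
        (parent-bound sum≤ (r≤R[child] false) (r≤R[child] true))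
      where
      sum≤ : 2 + inflow R x ≤ 3 * suc r
      sum≤ = subst (λ y → 2 + inflow R x ≤ 3 * y) R[x]≡1+r 2+inflow≤3R[x]
      r≤R[child] : ∀ b′ → r ≤ R (child x b′)
      r≤R[child] b′ = ≤-pred (subst (_≤ 1 + R (child x b′)) R[x]≡1+r
        (parent≤1+child′ I x b′ 1≤x
          (subst (_≤ height (child x b′)) (sym R[x]≡1+r)
            (subst (suc r ≤_) (sym (height-child b′ 1≤x)) (pred-mono-≤ low)))))

    balance-fire : ∀ {p} → 1 ≤ p → chipsAt N (fire c (firing x a b d)) p + inflow R′ p ≡ 1 ⊓ height p + 3 * R′ p
    balance-fire {p} 1≤p = +-cancelʳ-≡ (3 * δ x p) _ _ (begin
      chipsAt N c′ p + inflow R′ p + 3 * δ x p       ≡⟨ xy∙z≈xz∙y (chipsAt N c′ p) (inflow R′ p) (3 * δ x p) ⟩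
      chipsAt N c′ p + 3 * δ x p + inflow R′ p       ≡⟨ cong (_+ inflow R′ p) (Legal-chipsAt-fire legal p) ⟩
      chipsAt N c p + sent x p + inflow R′ p         ≡⟨ cong (λ s → chipsAt N c p + s + inflow R′ p) sent≡ ⟩
      chipsAt N c p + inflow (δ x) p + inflow R′ p   ≡⟨ xy∙z≈xz∙y (chipsAt N c p) (inflow (δ x) p) (inflow R′ p) ⟩
      chipsAt N c p + inflow R′ p + inflow (δ x) p   ≡⟨ +-assoc (chipsAt N c p) (inflow R′ p) (inflow (δ x) p) ⟩
      chipsAt N c p + (inflow R′ p + inflow (δ x) p) ≡⟨ cong (chipsAt N c p +_) inflow≡ ⟨
      chipsAt N c p + inflow R p                    ≡⟨ balance 1≤p ⟩
      1 ⊓ height p + 3 * R p                        ≡⟨ cong (λ y → 1 ⊓ height p + 3 * y) (afterFiring-split 1≤R[x] p) ⟩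
      1 ⊓ height p + 3 * (R′ p + δ x p)             ≡⟨ cong (1 ⊓ height p +_) (*-distribˡ-+ 3 (R′ p) (δ x p)) ⟩
      1 ⊓ height p + (3 * R′ p + 3 * δ x p)         ≡⟨ +-assoc (1 ⊓ height p) _ _ ⟨
      1 ⊓ height p + 3 * R′ p + 3 * δ x p           ∎)
      where
      open ≡-Reasoning
      c′ = fire c (firing x a b d)
      sent≡ : sent x p ≡ inflow (δ x) p
      sent≡ = trans (sent-sym 1≤x 1≤p) (sym (inflow-δ x p))
      inflow≡ : inflow R p ≡ inflow R′ p + inflow (δ x) p
      inflow≡ = trans (inflow-cong (afterFiring-split 1≤R[x]) p) (inflow-+ R′ (δ x) p)

    child≤parent-fire : ∀ q b′ → 1 ≤ q → 2 + R′ q ≤ height (child q b′) → R′ (child q b′) ≤ R′ q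
    child≤parent-fire q b′ 1≤q high with x ≟ q | x ≟ child q b′
    ... | yes refl | _ = begin
      R′ (child x b′)   ≡⟨ afterFiring-other R (<⇒≢ (<child b′ 1≤x)) ⟩
      R (child x b′)    ≤⟨ fired-child≤parent b′ (subst (λ y → 2 + y ≤ height (child x b′)) R′[x]≡r high) ⟩
      r                 ≡⟨ R′[x]≡r ⟨
      R′ x              ∎
      where open ≤-Reasoning
    ... | no x≢q | yes x≡child = begin
      R′ (child q b′)   ≡⟨ cong R′ x≡child ⟨
      R′ x              ≡⟨ R′[x]≡r ⟩
      r                 ≤⟨ r≤R[x] ⟩
      R x               ≡⟨ cong R x≡child ⟩
      R (child q b′)    ≤⟨ child≤parent q b′ 1≤q
                             (subst (λ y → 2 + y ≤ height (child q b′)) (afterFiring-other R x≢q) high) ⟩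
      R q               ≡⟨ afterFiring-other R x≢q ⟨
      R′ q              ∎
      where open ≤-Reasoning
    ... | no x≢q | no x≢child rewrite afterFiring-other R x≢q | afterFiring-other R x≢child =
      child≤parent q b′ 1≤q high

    parent≤1+child-fire : ∀ q b′ → 1 ≤ q → 2 + R′ (child q b′) ≤ height (child q b′) →
                          R′ q ≤ 1 + R′ (child q b′)
    parent≤1+child-fire q b′ 1≤q high with x ≟ q | x ≟ child q b′
    ... | yes refl | _ = begin
      R′ x                  ≡⟨ R′[x]≡r ⟩
      r                     ≤⟨ r≤R[x] ⟩
      R x                   ≤⟨ parent≤1+child x b′ 1≤x (subst (λ y → 2 + y ≤ height (child x b′)) R′[child]≡ high) ⟩
      1 + R (child x b′)    ≡⟨ cong suc R′[child]≡ ⟨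
      1 + R′ (child x b′)   ∎
      where
      open ≤-Reasoning
      R′[child]≡ : R′ (child x b′) ≡ R (child x b′)
      R′[child]≡ = afterFiring-other R (<⇒≢ (<child b′ 1≤x))
    ... | no x≢q | yes x≡child = begin
      R′ q                  ≡⟨ afterFiring-other R x≢q ⟩
      R q                   ≤⟨ parent≤1+fired {b = b′} 1≤q x≡child high′ ⟩
      1 + r                 ≡⟨ cong suc R′[x]≡r ⟨
      1 + R′ x              ≡⟨ cong (λ y → 1 + R′ y) x≡child ⟩
      1 + R′ (child q b′)   ∎
      where
      open ≤-Reasoning
      high′ : 2 + r ≤ height x
      high′ = subst (λ y → 2 + y ≤ height x) R′[x]≡r (subst (λ y → 2 + R′ y ≤ height y) (sym x≡child) high)
    ... | no x≢q | no x≢child rewrite afterFiring-other R x≢q | afterFiring-other R x≢child =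
      parent≤1+child q b′ 1≤q high

    positions-positive-fire : ∀ ℓ → 1 ≤ fire c (firing x a b d) ℓ
    positions-positive-fire ℓ with ℓ ≡ᵇ a | ℓ ≡ᵇ b | ℓ ≡ᵇ d
    ... | true | _ | _ = child-≥1 false 1≤x
    ... | false | true | _ = parent-≥1 1≤x
    ... | false | false | true = child-≥1 true 1≤x
    ... | false | false | false = positions-positive ℓ

    invariant : Invariant (fire c (firing x a b d)) R′
    invariant = record
      { positions-positive = positions-positive-fire
      ; balance = balance-fire
      ; bounded = λ {p} 1≤p → ≤-trans (m∸n≤m (R p) (δ x p)) (bounded 1≤p)
      ; child≤parent = child≤parent-fire
      ; parent≤1+child = parent≤1+child-fire
      }

  Invariant-cong : ∀ {c R S} → (∀ {p} → 1 ≤ p → R p ≡ S p) → Invariant c R → Invariant c S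
  Invariant-cong {c} {R} {S} R≗S I = record
    { positions-positive = positions-positive
    ; balance = λ {p} 1≤p → subst₂ (λ i s → chipsAt N c p + i ≡ 1 ⊓ height p + 3 * s)
                                    (inflow≡ 1≤p) (R≗S 1≤p) (balance 1≤p)
    ; bounded = λ 1≤p → subst (_≤ totalFirings _) (R≗S 1≤p) (bounded 1≤p)
    ; child≤parent = λ q b 1≤q high → subst₂ _≤_ (R≗S (child-≥1 b 1≤q)) (R≗S 1≤q)
        (child≤parent q b 1≤q (subst (λ s → 2 + s ≤ height (child q b)) (sym (R≗S 1≤q)) high))
    ; parent≤1+child = λ q b 1≤q high → subst₂ (λ s s′ → s ≤ 1 + s′) (R≗S 1≤q) (R≗S (child-≥1 b 1≤q))
        (parent≤1+child q b 1≤q (subst (λ s → 2 + s ≤ height (child q b)) (sym (R≗S (child-≥1 b 1≤q))) high))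
    }
    where
    open Invariant I
    inflow≡ : ∀ {p} → 1 ≤ p → inflow R p ≡ inflow S p
    inflow≡ 1≤p =
      cong₂ _+_ (cong₂ _+_ (R≗S (child-≥1 false 1≤p)) (R≗S (parent-≥1 1≤p))) (R≗S (child-≥1 true 1≤p))

  -- With at most two chips per node, the balance at a node where R attains a positive maximum forces a
  -- child to share it; descending, one reaches height 0, where R vanishes.
  module Terminated {c R} (I : Invariant c R) (terminal : Terminal N c) where
    open Invariant I

    maximum-descends : ∀ {M p} → (∀ {q} → 1 ≤ q → R q ≤ suc M) → 1 ≤ p → R p ≡ suc M →
                       Σ Bool λ b → R (child p b) ≡ suc M
    maximum-descends {M} {p} R≤ 1≤p R[p]≡ with R (child p false) ≟ suc M | R (child p true) ≟ suc M
    ... | yes R[c₀]≡ | _ = false , R[c₀]≡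
    ... | no _ | yes R[c₁]≡ = true , R[c₁]≡
    ... | no R[c₀]≢ | no R[c₁]≢ = contradiction balance′ (<⇒≢
            (terminal-bound (≤-pred (terminal p)) (below false R[c₀]≢) (R≤ (parent-≥1 1≤p)) (below true R[c₁]≢)))
      where
      below : ∀ b → R (child p b) ≢ suc M → R (child p b) ≤ M
      below b ≢ = ≤-pred (≤∧≢⇒< (R≤ (child-≥1 b 1≤p)) ≢)
      1≤height : 1 ≤ height p
      1≤height = fireCount-≥1 (≤-trans (s≤s z≤n) (subst (_≤ totalFirings p) R[p]≡ (bounded 1≤p)))
      balance′ : chipsAt N c p + inflow R p ≡ 1 + 3 * suc M
      balance′ = trans (balance 1≤p) (cong₂ (λ m s → m + 3 * s) (1⊓-≥1 1≤height) R[p]≡)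

    no-maximum : ∀ {M} → (∀ {q} → 1 ≤ q → R q ≤ suc M) → ∀ h {p} → 1 ≤ p → height p ≤ h → R p ≢ suc M
    no-maximum {M} R≤ zero {p} 1≤p height≤0 R[p]≡ =
      contradiction (subst (_≤ totalFirings p) R[p]≡ (bounded 1≤p))
        (subst (λ h → ¬ suc M ≤ fireCount h) (sym (n≤0⇒n≡0 height≤0)) λ ())
    no-maximum R≤ (suc h) {p} 1≤p height≤1+h R[p]≡ with maximum-descends R≤ 1≤p R[p]≡
    ... | b , R[child]≡ = no-maximum R≤ h (child-≥1 b 1≤p)
            (subst (_≤ h) (sym (height-child b 1≤p)) (pred-mono-≤ height≤1+h)) R[child]≡

    remaining-zero : ∀ {p} → 1 ≤ p → R p ≡ 0
    remaining-zero = bounded-by (fireCount n) λ 1≤q → ≤-trans (bounded 1≤q) (fireCount-mono (height≤n _))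
      where
      bounded-by : ∀ M → (∀ {q} → 1 ≤ q → R q ≤ M) → ∀ {p} → 1 ≤ p → R p ≡ 0
      bounded-by zero R≤0 1≤p = n≤0⇒n≡0 (R≤0 1≤p)
      bounded-by (suc M) R≤ =
        bounded-by M λ 1≤q → ≤-pred (≤∧≢⇒< (R≤ 1≤q) (no-maximum R≤ n 1≤q (height≤n _)))

  remaining-firings : ∀ {c R fs} → Invariant c R → ValidSeq N c fs → Terminal N (run c fs) →
                      ∀ {p} → 1 ≤ p → R p ≡ countNode p fs
  remaining-firings {fs = []} I _ terminal = Terminated.remaining-zero I terminal
  remaining-firings {R = R} {fs = f@(firing x _ _ _) ∷ fs} I (legal , valid) terminal {p} 1≤p = begin
    R p
      ≡⟨ afterFiring-split (FiringStep.1≤R[x] I legal) p ⟩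
    afterFiring R x p + δ x p
      ≡⟨ cong (_+ δ x p) (remaining-firings (FiringStep.invariant I legal) valid terminal 1≤p) ⟩
    countNode p fs + δ x p
      ≡⟨ +-comm (countNode p fs) (δ x p) ⟩
    δ x p + countNode p fs
      ≡⟨ countNode-∷ p f fs ⟨
    countNode p (f ∷ fs) ∎
    where open ≡-Reasoning

  invariant-suffix : ∀ {c R fs} → Invariant c R → ValidSeq N c fs → Terminal N (run c fs) →
                     ∀ t → Invariant (configBefore c fs t) (remaining fs t)
  invariant-suffix I valid terminal zero = Invariant-cong (remaining-firings I valid terminal) I
  invariant-suffix {fs = []} I valid terminal (suc t) = Invariant-cong (remaining-firings I valid terminal) I
  invariant-suffix {fs = firing _ _ _ _ ∷ fs} I (legal , valid) terminal (suc t) =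
    invariant-suffix (FiringStep.invariant I legal) valid terminal t

  -- Interleaving of parent and child firings

  module _ {fs} (complete : Complete N initial fs) {q b j} (1≤q : 1 ≤ q) (room : 2 + j ≤ height (child q b)) where

    invariant-at : ∀ t → Invariant (configBefore initial fs t) (remaining fs t)
    invariant-at = invariant-suffix initial-invariant (proj₁ complete) (proj₂ complete)

    countNode≡totalFirings : ∀ {p} → 1 ≤ p → countNode p fs ≡ totalFirings p
    countNode≡totalFirings 1≤p = sym (remaining-firings initial-invariant (proj₁ complete) (proj₂ complete) 1≤p)

    1≤i : 1 ≤ child q b
    1≤i = child-≥1 b 1≤q

    j<countNode-child : j < countNode (child q b) fs
    j<countNode-child = subst (j <_) (sym (countNode≡totalFirings 1≤i))
      (≤-pred (≤-trans room (h≤1+fireCount (height (child q b)))))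

    1+j<countNode-parent : suc j < countNode q fs
    1+j<countNode-parent = subst (suc j <_) (sym (countNode≡totalFirings 1≤q))
      (subst (λ h → 2 + j ≤ fireCount h) (sym (height-parent b 1≤q (≤-trans (s≤s z≤n) room)))
        (≤-trans room (m≤n+m _ (2 * fireCount (height (child q b))))))

    module _ (t : ℕ) (firingAt : IsFiringAt fs (child q b) j t) where

      R[i]≡1+j : remaining fs t (child q b) ≡ suc j
      R[i]≡1+j = IsFiringAt-remaining fs t firingAt

      R⁺[i]≡j : remaining fs (suc t) (child q b) ≡ j
      R⁺[i]≡j = IsFiringAt-remaining-suc fs t firingAt

      R⁺[q]≡R[q] : remaining fs (suc t) q ≡ remaining fs t q
      R⁺[q]≡R[q] = IsFiringAt-remaining-other fs t firingAt (child≢ b 1≤q)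

      R[q]≡1+j : remaining fs t q ≡ suc j
      R[q]≡1+j = ≤-antisym upper lower
        where
        upper : remaining fs t q ≤ suc j
        upper = subst₂ (λ s s′ → s ≤ 1 + s′) R⁺[q]≡R[q] R⁺[i]≡j
          (Invariant.parent≤1+child (invariant-at (suc t)) q b 1≤q
            (subst (λ s → 2 + s ≤ height (child q b)) (sym R⁺[i]≡j) room))
        lower : suc j ≤ remaining fs t q
        lower = subst (_≤ remaining fs t q) R[i]≡1+j
          (child≤parent′ (invariant-at t) q b 1≤q
            (subst (λ s → 1 + s ≤ height (child q b)) (sym R[i]≡1+j) room))

      chips-at-firing : chipsAt N (configBefore initial fs t) (child q b) ≡ 3
      chips-at-firing = ≤-antisym
        (chips-bound balance-at-i R[parent]≡ (j≤R[child] false) (j≤R[child] true))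
        (IsFiringAt-3≤chipsAt fs t (proj₁ complete) firingAt)
        where
        open Invariant (invariant-at t)
        balance-at-i : chipsAt N (configBefore initial fs t) (child q b) + inflow (remaining fs t) (child q b)
                       ≡ 1 + 3 * suc j
        balance-at-i = trans (balance 1≤i) (cong₂ (λ m s → m + 3 * s) (1⊓-≥1 (≤-trans (s≤s z≤n) room)) R[i]≡1+j)
        R[parent]≡ : remaining fs t (parent (child q b)) ≡ suc j
        R[parent]≡ = trans (cong (remaining fs t) (parent-child b 1≤q)) R[q]≡1+j
        j≤R[child] : ∀ b′ → j ≤ remaining fs t (child (child q b) b′)
        j≤R[child] b′ = ≤-pred (subst (_≤ 1 + remaining fs t (child (child q b) b′)) R[i]≡1+j
          (parent≤1+child′ (invariant-at t) (child q b) b′ 1≤i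
            (subst₂ _≤_ (sym R[i]≡1+j) (sym (height-child b′ 1≤i)) (pred-mono-≤ room))))

    interleaving : Interleaved N fs q (child q b) j
    interleaving
      with firing-exists fs q (suc j) 1+j<countNode-parent
         | firing-exists fs (child q b) j j<countNode-child
         | firing-exists fs q j (<-trans (n<1+n j) 1+j<countNode-parent)
    ... | t₁ , w₁ | t₂ , w₂ | t₃ , w₃ = t₁ , t₂ , t₃ , w₁ , w₂ , w₃ , t₁<t₂ , t₂<t₃ , chips-at-firing t₂ w₂
      where
      t₁<t₂ : t₁ < t₂
      t₁<t₂ = <-from-remaining fs q
        (subst₂ _<_ (sym (R[q]≡1+j t₂ w₂)) (sym (IsFiringAt-remaining fs t₁ w₁)) ≤-refl)
      t₂<t₃ : t₂ < t₃
      t₂<t₃ = ≤-pred (<-from-remaining fs q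
        (subst₂ _<_ (sym (IsFiringAt-remaining-suc fs t₃ w₃))
                    (sym (trans (R⁺[q]≡R[q] t₂ w₂) (R[q]≡1+j t₂ w₂))) ≤-refl))

room-from-level : ∀ a j n → a + 1 + j < n → 2 + j ≤ n ∸ a
room-from-level a j n a+1+j<n = m+n≤o⇒m≤o∸n (2 + j) (subst (_≤ n) (reorder a j) a+1+j<n)
  where
  reorder : ∀ a j → suc (a + 1 + j) ≡ 2 + j + a
  reorder = solve-∀

proposition4p1 : (n : ℕ) → 1 ≤ n → (i : ℕ) → 1 ≤ i → 1 < level i →
    (j : ℕ) → level i + j < n →
    (fs : List Firing) → Complete (2 ^ n ∸ 1) initial fs →
    Σ ℕ λ t₁ → Σ ℕ λ t₂ → Σ ℕ λ t₃ →
      IsFiringAt fs ⌊ i /2⌋ (1 + j) t₁ × IsFiringAt fs i j t₂ × IsFiringAt fs ⌊ i /2⌋ j t₃ ×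
      t₁ < t₂ × t₂ < t₃ × chipsAt (2 ^ n ∸ 1) (configBefore initial fs t₂) i ≡ 3
-- The hypotheses 1 ≤ n and 1 ≤ i follow from the others.
proposition4p1 n _ (suc zero) _ (s≤s ())
proposition4p1 n _ i@(suc (suc _)) _ _ j level+j<n fs complete with child-⌊/2⌋ i
... | b , child≡i =
  subst (λ i′ → Interleaved (2 ^ n ∸ 1) fs ⌊ i /2⌋ i′ j) child≡i
    (Process.interleaving n complete {b = b} (s≤s z≤n) room)
  where
  room : 2 + j ≤ Process.height n (child ⌊ i /2⌋ b)
  room = subst (λ i′ → 2 + j ≤ Process.height n i′) (sym child≡i)
           (subst (2 + j ≤_) (sym (Process.height≡ n i)) (room-from-level ⌊log₂ i ⌋ j n level+j<n))
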